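{- For every finite simple graph $G$, the edge-biclique hypergraph $\mathcal{EB}(G)$ is a partial hypergraph of the clique hypergraph $\mathcal{K}(L_G)$; that is, for every biclique $B$ of $G$, the edge set $E(G[B])$ is a clique of $L_G$.
   Context: A biclique of $G$ is a vertex set $B\subseteq V(G)$ such that $G[B]$ is a complete bipartite graph and $B$ is inclusion-wise maximal with this property. The edge-biclique hypergraph $\mathcal{EB}(G)$ has vertex set $E(G)$ and its hyperedges are the edge sets $E(G[B])$ of the bicliques $B$ of $G$. The biclique line graph $L_G$ has vertex set $E(G)$, two edges of $G$ being adjacent iff they are both edges of $G[B]$ for some biclique $B$ of $G$. A clique of a graph is an inclusion-wise maximal vertex set inducing a complete graph, and $\mathcal{K}(H)$ is the hypergraph on $V(H)$ whose hyperedges are the cliques of $H$. A partial hypergraph of $(V,\mathcal{E})$ is a hypergraph $(V,\mathcal{E}')$ with $\mathcal{E}'\subseteq\mathcal{E}$. -}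

module Defs where

open import Data.Nat using (ℕ)
open import Data.Bool using (Bool; true; false)
open import Data.Fin using (Fin; _<_)
open import Data.Fin.Subset using (Subset; _∈_; _∉_; _⊆_)
open import Data.Product using (Σ; ∃; ∃-syntax; _×_; _,_)
open import Data.Sum using (_⊎_)
open import Data.Empty using (⊥)
open import Relation.Nullary using (¬_)
open import Relation.Binary.PropositionalEquality using (_≡_; _≢_)
open import Level using (suc; zero)

record Graph : Set where
  field
    n      : ℕ
    adj    : Fin n → Fin n → Bool
    sym    : ∀ u v → adj u v ≡ adj v u
    irrefl : ∀ v → adj v v ≡ false

module _ (G : Graph) where
  open Graph G

  Adj : Fin n → Fin n → Set
  Adj u v = adj u v ≡ true

  IsCompleteBipartite : Subset n → Set
  IsCompleteBipartite B =
    Σ (Subset n) λ X → Σ (Subset n) λ Y →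
      (∀ v → v ∈ B → v ∈ X ⊎ v ∈ Y) ×
      (X ⊆ B) × (Y ⊆ B) ×
      (∀ v → v ∈ X → v ∉ Y) ×
      (∃[ x ] x ∈ X) × (∃[ y ] y ∈ Y) ×
      (∀ x y → x ∈ X → y ∈ Y → Adj x y) ×
      (∀ x x' → x ∈ X → x' ∈ X → ¬ Adj x x') ×
      (∀ y y' → y ∈ Y → y' ∈ Y → ¬ Adj y y')

  IsBiclique : Subset n → Set
  IsBiclique B = IsCompleteBipartite B ×
    (∀ B' → B ⊆ B' → IsCompleteBipartite B' → B' ⊆ B)

  -- Edges of G: unordered pairs {u, v}, represented with u < v.
  record Edge : Set where
    constructor edge
    field
      u   : Fin n
      v   : Fin n
      u<v : u < v
      uv  : Adj u v

  EdgesIn : Subset n → Edge → Set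
  EdgesIn B e = Edge.u e ∈ B × Edge.v e ∈ B

  LAdj : Edge → Edge → Set
  LAdj e f = e ≢ f × (Σ (Subset n) λ B → IsBiclique B × EdgesIn B e × EdgesIn B f)

  EdgeSet : Set₁
  EdgeSet = Edge → Set

  _⊆E_ : EdgeSet → EdgeSet → Set
  S ⊆E T = ∀ e → S e → T e

  IsComplete : EdgeSet → Set
  IsComplete S = ∀ e f → S e → S f → e ≢ f → LAdj e f

  IsCliqueL : EdgeSet → Set₁
  IsCliqueL S = IsComplete S × (∀ T → S ⊆E T → IsComplete T → T ⊆E S)

-- Let T be a complete set of vertices of L_G containing E(G[B]), and let w be an endpoint
-- of some g ∈ T that lies outside B. Each edge xy of G[B] differs from g, so g and xy lie
-- in a common biclique C; w ∈ C, and in the complete bipartite graph G[C] every vertex is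
-- adjacent to exactly one end of each edge. Hence w is adjacent to exactly one end of every
-- edge of G[B], so it sees all of one side of B and none of the other. Then B ∪ {w} is
-- still complete bipartite, contradicting the maximality of B.
module Submission where

open import Defs
open import Data.Bool using (Bool; true; not)
open import Data.Bool.Properties using (¬-not; _≟_)
open import Data.Fin using (Fin)
open import Data.Fin.Properties using (<-cmp)
open import Data.Fin.Subset using (Subset; _∈_; _∉_; _⊆_; _∪_; ⁅_⁆)
open import Data.Fin.Subset.Properties using (_∈?_; x∈⁅x⁆; x∈⁅y⁆⇒x≡y; p⊆p∪q; q⊆p∪q; x∈p∪q⁻)
open import Data.Product using (Σ-syntax; ∃-syntax; _×_; _,_; proj₁; proj₂; uncurry)
open import Data.Sum using (_⊎_; inj₁; inj₂) renaming (swap to ⊎-swap)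
open import Data.Empty using (⊥-elim)
open import Function using (_∘_)
open import Relation.Nullary using (¬_; Dec; yes; no)
open import Relation.Binary using (tri<; tri≈; tri>)
open import Relation.Binary.PropositionalEquality using (_≡_; _≢_; refl; sym; trans; cong; subst; ≢-sym)

∈-∪-⁅⁆⁻ : ∀ {m} {v w : Fin m} (p : Subset m) → v ∈ p ∪ ⁅ w ⁆ → v ∈ p ⊎ v ≡ w
∈-∪-⁅⁆⁻ {w = w} p v∈ with x∈p∪q⁻ p ⁅ w ⁆ v∈
... | inj₁ v∈p = inj₁ v∈p
... | inj₂ v∈w = inj₂ (x∈⁅y⁆⇒x≡y w v∈w)

≢∧≢true⇒≡true : ∀ {a b : Bool} → a ≢ b → b ≢ true → a ≡ true
≢∧≢true⇒≡true a≢b b≢true = trans (¬-not a≢b) (cong not (¬-not b≢true))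

module _ (G : Graph) where
  open Graph G using (n; adj) renaming (sym to adj-sym; irrefl to adj-irrefl)
  open Edge

  Adj-sym : ∀ {u v} → Adj G u v → Adj G v u
  Adj-sym {u} {v} uv = trans (adj-sym v u) uv

  Adj-irrefl : ∀ {v} → ¬ Adj G v v
  Adj-irrefl {v} vv with trans (sym vv) (adj-irrefl v)
  ... | ()

  record CompleteBipartition (B : Subset n) : Set where
    field
      X Y           : Subset n
      covers        : ∀ v → v ∈ B → v ∈ X ⊎ v ∈ Y
      X⊆B           : X ⊆ B
      Y⊆B           : Y ⊆ B
      disjoint      : ∀ v → v ∈ X → v ∉ Y
      X-nonempty    : ∃[ x ] x ∈ X
      Y-nonempty    : ∃[ y ] y ∈ Y
      complete      : ∀ x y → x ∈ X → y ∈ Y → Adj G x y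
      X-independent : ∀ x x' → x ∈ X → x' ∈ X → ¬ Adj G x x'
      Y-independent : ∀ y y' → y ∈ Y → y' ∈ Y → ¬ Adj G y y'

  open CompleteBipartition

  fromIsCompleteBipartite : ∀ {B} → IsCompleteBipartite G B → CompleteBipartition B
  fromIsCompleteBipartite (X , Y , cov , X⊆B , Y⊆B , disj , ∃x , ∃y , cross , indX , indY) =
    record { X = X ; Y = Y ; covers = cov ; X⊆B = X⊆B ; Y⊆B = Y⊆B ; disjoint = disj
           ; X-nonempty = ∃x ; Y-nonempty = ∃y ; complete = cross
           ; X-independent = indX ; Y-independent = indY }

  toIsCompleteBipartite : ∀ {B} → CompleteBipartition B → IsCompleteBipartite G B
  toIsCompleteBipartite P =
    X P , Y P , covers P , X⊆B P , Y⊆B P , disjoint P , X-nonempty P , Y-nonempty P ,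
    complete P , X-independent P , Y-independent P

  swapSides : ∀ {B} → CompleteBipartition B → CompleteBipartition B
  swapSides P = record
    { X = Y P ; Y = X P
    ; covers = λ v v∈B → ⊎-swap (covers P v v∈B)
    ; X⊆B = Y⊆B P ; Y⊆B = X⊆B P
    ; disjoint = λ v v∈Y v∈X → disjoint P v v∈X v∈Y
    ; X-nonempty = Y-nonempty P ; Y-nonempty = X-nonempty P
    ; complete = λ y x y∈Y x∈X → Adj-sym (complete P x y x∈X y∈Y)
    ; X-independent = Y-independent P ; Y-independent = X-independent P
    }

  Separates : Fin n → Edge G → Set
  Separates w e = adj w (u e) ≢ adj w (v e)

  separates-edges : ∀ {C} → CompleteBipartition C → ∀ {w} → w ∈ C →
                    ∀ e → EdgesIn G C e → Separates w e
  separates-edges P {w} w∈C e (u∈C , v∈C)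
    with covers P (u e) u∈C | covers P (v e) v∈C | covers P w w∈C
  ... | inj₁ u∈X | inj₁ v∈X | _   = ⊥-elim (X-independent P _ _ u∈X v∈X (uv e))
  ... | inj₂ u∈Y | inj₂ v∈Y | _   = ⊥-elim (Y-independent P _ _ u∈Y v∈Y (uv e))
  ... | inj₁ u∈X | inj₂ v∈Y | inj₁ w∈X =
    λ eq → X-independent P w (u e) w∈X u∈X (trans eq (complete P w (v e) w∈X v∈Y))
  ... | inj₁ u∈X | inj₂ v∈Y | inj₂ w∈Y =
    λ eq → Y-independent P w (v e) w∈Y v∈Y (trans (sym eq) (Adj-sym (complete P (u e) w u∈X w∈Y)))
  ... | inj₂ u∈Y | inj₁ v∈X | inj₁ w∈X =
    λ eq → X-independent P w (v e) w∈X v∈X (trans (sym eq) (complete P w (u e) w∈X u∈Y))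
  ... | inj₂ u∈Y | inj₁ v∈X | inj₂ w∈Y =
    λ eq → Y-independent P w (u e) w∈Y u∈Y (trans eq (Adj-sym (complete P (v e) w v∈X w∈Y)))

  data Joins : Edge G → Fin n → Fin n → Set where
    forwards  : ∀ {e} → Joins e (u e) (v e)
    backwards : ∀ {e} → Joins e (v e) (u e)

  edge-joining : ∀ {x y} → Adj G x y → Σ[ e ∈ Edge G ] Joins e x y
  edge-joining {x} {y} xy with <-cmp x y
  ... | tri< x<y _ _ = edge x y x<y xy , forwards
  ... | tri≈ _ refl _ = ⊥-elim (Adj-irrefl xy)
  ... | tri> _ _ y<x = edge y x y<x (Adj-sym xy) , backwards

  joins-∈ : ∀ {B e x y} → Joins e x y → x ∈ B → y ∈ B → EdgesIn G B e
  joins-∈ forwards  x∈B y∈B = x∈B , y∈B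
  joins-∈ backwards x∈B y∈B = y∈B , x∈B

  joins-separates : ∀ {w e x y} → Joins e x y → Separates w e → adj w x ≢ adj w y
  joins-separates forwards  s = s
  joins-separates backwards s = ≢-sym s

  extend : ∀ {B w} (P : CompleteBipartition B) →
           (∀ x → x ∈ X P → Adj G w x) → (∀ y → y ∈ Y P → ¬ Adj G w y) →
           CompleteBipartition (B ∪ ⁅ w ⁆)
  extend {B} {w} P w-X w-Y = record
    { X = X P ; Y = Y P ∪ ⁅ w ⁆
    ; covers = covers′
    ; X⊆B = p⊆p∪q ⁅ w ⁆ ∘ X⊆B P
    ; Y⊆B = Y′⊆B′
    ; disjoint = disjoint′
    ; X-nonempty = X-nonempty P
    ; Y-nonempty = proj₁ (Y-nonempty P) , p⊆p∪q ⁅ w ⁆ (proj₂ (Y-nonempty P))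
    ; complete = complete′
    ; X-independent = X-independent P
    ; Y-independent = independent′
    }
    where
    w∈Y′ : w ∈ Y P ∪ ⁅ w ⁆
    w∈Y′ = q⊆p∪q (Y P) ⁅ w ⁆ (x∈⁅x⁆ w)

    covers′ : ∀ v → v ∈ B ∪ ⁅ w ⁆ → v ∈ X P ⊎ v ∈ Y P ∪ ⁅ w ⁆
    covers′ v v∈ with ∈-∪-⁅⁆⁻ B v∈
    ... | inj₂ refl = inj₂ w∈Y′
    ... | inj₁ v∈B with covers P v v∈B
    ...   | inj₁ v∈X = inj₁ v∈X
    ...   | inj₂ v∈Y = inj₂ (p⊆p∪q ⁅ w ⁆ v∈Y)

    Y′⊆B′ : Y P ∪ ⁅ w ⁆ ⊆ B ∪ ⁅ w ⁆
    Y′⊆B′ v∈ with ∈-∪-⁅⁆⁻ (Y P) v∈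
    ... | inj₁ v∈Y = p⊆p∪q ⁅ w ⁆ (Y⊆B P v∈Y)
    ... | inj₂ refl = q⊆p∪q B ⁅ w ⁆ (x∈⁅x⁆ w)

    disjoint′ : ∀ v → v ∈ X P → v ∉ Y P ∪ ⁅ w ⁆
    disjoint′ v v∈X v∈ with ∈-∪-⁅⁆⁻ (Y P) v∈
    ... | inj₁ v∈Y = disjoint P v v∈X v∈Y
    ... | inj₂ refl = Adj-irrefl (w-X w v∈X)

    complete′ : ∀ x y → x ∈ X P → y ∈ Y P ∪ ⁅ w ⁆ → Adj G x y
    complete′ x y x∈X y∈ with ∈-∪-⁅⁆⁻ (Y P) y∈
    ... | inj₁ y∈Y = complete P x y x∈X y∈Y
    ... | inj₂ refl = Adj-sym (w-X x x∈X)

    independent′ : ∀ y y' → y ∈ Y P ∪ ⁅ w ⁆ → y' ∈ Y P ∪ ⁅ w ⁆ → ¬ Adj G y y'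
    independent′ y y' y∈ y'∈ with ∈-∪-⁅⁆⁻ (Y P) y∈ | ∈-∪-⁅⁆⁻ (Y P) y'∈
    ... | inj₁ y∈Y | inj₁ y'∈Y = Y-independent P y y' y∈Y y'∈Y
    ... | inj₁ y∈Y | inj₂ refl = w-Y y y∈Y ∘ Adj-sym
    ... | inj₂ refl | inj₁ y'∈Y = w-Y y' y'∈Y
    ... | inj₂ refl | inj₂ refl = Adj-irrefl

  biclique-absorbs : ∀ {B w} → IsBiclique G B → (P : CompleteBipartition B) →
                     (∀ x → x ∈ X P → Adj G w x) → (∀ y → y ∈ Y P → ¬ Adj G w y) → w ∈ B
  biclique-absorbs {B} {w} (_ , maximal) P w-X w-Y =
    maximal (B ∪ ⁅ w ⁆) (p⊆p∪q ⁅ w ⁆) (toIsCompleteBipartite (extend P w-X w-Y))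
      (q⊆p∪q B ⁅ w ⁆ (x∈⁅x⁆ w))

  -- Given one neighbour x₀ ∈ X, separating each pair x₀y forces w to miss all of Y,
  -- and then separating each pair xy₀ forces w to see all of X.
  separating-vertex-sees-X : ∀ {B w} (P : CompleteBipartition B) →
    (∀ x y → x ∈ X P → y ∈ Y P → adj w x ≢ adj w y) →
    ∀ {x₀} → x₀ ∈ X P → Adj G w x₀ →
    (∀ x → x ∈ X P → Adj G w x) × (∀ y → y ∈ Y P → ¬ Adj G w y)
  separating-vertex-sees-X {w = w} P sep x₀∈X wx₀ = sees-X , misses-Y
    where
    misses-Y : ∀ y → y ∈ Y P → ¬ Adj G w y
    misses-Y y y∈Y wy = sep _ y x₀∈X y∈Y (trans wx₀ (sym wy))

    sees-X : ∀ x → x ∈ X P → Adj G w x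
    sees-X x x∈X = ≢∧≢true⇒≡true (sep x y₀ x∈X y₀∈Y) (misses-Y y₀ y₀∈Y)
      where
      y₀ : Fin n
      y₀ = proj₁ (Y-nonempty P)

      y₀∈Y : y₀ ∈ Y P
      y₀∈Y = proj₂ (Y-nonempty P)

  separates-pairs : ∀ {B w} (P : CompleteBipartition B) →
    (∀ e → EdgesIn G B e → Separates w e) →
    ∀ x y → x ∈ X P → y ∈ Y P → adj w x ≢ adj w y
  separates-pairs P sep x y x∈X y∈Y with edge-joining (complete P x y x∈X y∈Y)
  ... | e , joins = joins-separates joins (sep e (joins-∈ joins (X⊆B P x∈X) (Y⊆B P y∈Y)))

  separating-vertex∈biclique : ∀ {B w} → IsBiclique G B →
    (∀ e → EdgesIn G B e → Separates w e) → w ∈ B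
  separating-vertex∈biclique {B} {w} bic@(cb , _) sep = absorb (adj w x₀ ≟ true)
    where
    P : CompleteBipartition B
    P = fromIsCompleteBipartite cb

    x₀ y₀ : Fin n
    x₀ = proj₁ (X-nonempty P)
    y₀ = proj₁ (Y-nonempty P)

    x₀∈X : x₀ ∈ X P
    x₀∈X = proj₂ (X-nonempty P)

    y₀∈Y : y₀ ∈ Y P
    y₀∈Y = proj₂ (Y-nonempty P)

    sep-XY : ∀ x y → x ∈ X P → y ∈ Y P → adj w x ≢ adj w y
    sep-XY = separates-pairs P sep

    absorb : Dec (Adj G w x₀) → w ∈ B
    absorb (yes wx₀) =
      uncurry (biclique-absorbs bic P) (separating-vertex-sees-X P sep-XY x₀∈X wx₀)
    absorb (no ¬wx₀) =
      uncurry (biclique-absorbs bic (swapSides P))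
        (separating-vertex-sees-X (swapSides P) (λ y x y∈Y x∈X → ≢-sym (sep-XY x y x∈X y∈Y))
          y₀∈Y (≢∧≢true⇒≡true (≢-sym (sep-XY x₀ y₀ x₀∈X y₀∈Y)) ¬wx₀))

  endpoint∈biclique : ∀ {B} → IsBiclique G B →
    ∀ T → (∀ e → EdgesIn G B e → T e) → IsComplete G T →
    ∀ {g} → T g → ∀ {w} → (∀ {C} → EdgesIn G C g → w ∈ C) → w ∈ B
  endpoint∈biclique {B} bic T E[B]⊆T T-complete {g} g∈T {w} endpoint with w ∈? B
  ... | yes w∈B = w∈B
  ... | no w∉B = separating-vertex∈biclique bic separates
    where
    separates : ∀ e → EdgesIn G B e → Separates w e
    separates e e∈B
      with T-complete g e g∈T (E[B]⊆T e e∈B)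
             (λ g≡e → w∉B (endpoint (subst (EdgesIn G B) (sym g≡e) e∈B)))
    ... | _ , C , (C-bipartite , _) , g∈C , e∈C =
      separates-edges (fromIsCompleteBipartite C-bipartite) (endpoint g∈C) e e∈C

lemma3 : (G : Graph) → (B : Subset (Graph.n G)) → IsBiclique G B →
    IsCliqueL G (EdgesIn G B)
lemma3 G B bic = complete , maximal
  where
  complete : IsComplete G (EdgesIn G B)
  complete e f e∈B f∈B e≢f = e≢f , B , bic , e∈B , f∈B

  maximal : ∀ T → _⊆E_ G (EdgesIn G B) T → IsComplete G T → _⊆E_ G T (EdgesIn G B)
  maximal T E[B]⊆T T-complete g g∈T =
    endpoint∈biclique G bic T E[B]⊆T T-complete g∈T proj₁ ,
    endpoint∈biclique G bic T E[B]⊆T T-complete g∈T proj₂
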